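{- Let $Q=(q_k)_{k\ge1}$ be a sequence of integers with $q_k>1$, let $\varepsilon_k\in\{0,1,\dots,q_k-1\}$ for all $k$, and let $x=\sum_{k=1}^\infty\frac{\varepsilon_k}{q_1q_2\cdots q_k}$. Then $x$ is rational if and only if there exist integers $n\ge0$ and $m\ge1$ such that $$\sum_{k=n+1}^\infty\frac{\varepsilon_k}{q_1q_2\cdots q_k}=q_{n+1}q_{n+2}\cdots q_{n+m}\sum_{k=n+m+1}^\infty\frac{\varepsilon_k}{q_1q_2\cdots q_k}.$$ -}

module Defs where

open import Data.Nat as ℕ using (ℕ; zero; suc; _+_; _*_; _≤_; _<_; NonZero; s≤s; z≤n)
open import Data.Nat.Properties as ℕP using (m*n≢0; m≤n+m; ≤-trans)
open import Data.Integer using (+_)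
open import Data.Rational using (ℚ; 0ℚ; _/_; _-_; ∣_∣) renaming (_+_ to _+ℚ_; _*_ to _*ℚ_; _<_ to _<ℚ_)
open import Data.Product using (∃; ∃-syntax)

-- Paper indexing: q_k, ε_k for k ≥ 1; the values at index 0 are irrelevant.
-- A base sequence: every q_k (k ≥ 1) is an integer > 1.
IsBase : (ℕ → ℕ) → Set
IsBase q = ∀ k → 1 ≤ k → 1 < q k

qprod : (ℕ → ℕ) → ℕ → ℕ → ℕ
qprod q a zero = 1
qprod q a (suc l) = qprod q a l * q (a + suc l)

qprod-nz : (q : ℕ → ℕ) → IsBase q → ∀ a l → NonZero (qprod q a l)
qprod-nz q hq a zero = _
qprod-nz q hq a (suc l) =
  m*n≢0 (qprod q a l) (q (a + suc l))
    {{qprod-nz q hq a l}}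
    {{ℕ.>-nonZero (≤-trans (s≤s z≤n) (hq (a + suc l) (≤-trans (s≤s z≤n) (m≤n+m (suc l) a))))}}

term : (q : ℕ → ℕ) → IsBase q → (ℕ → ℕ) → ℕ → ℚ
term q hq e k = _/_ (+ e k) (qprod q 0 k) {{qprod-nz q hq 0 k}}

tailSum : (q : ℕ → ℕ) → IsBase q → (ℕ → ℕ) → ℕ → ℕ → ℚ
tailSum q hq e n zero = 0ℚ
tailSum q hq e n (suc N) = tailSum q hq e n N +ℚ term q hq e (n + suc N)

ConvergesTo : (ℕ → ℚ) → ℚ → Set
ConvergesTo s r = ∀ (δ : ℚ) → 0ℚ <ℚ δ → ∃[ N ] (∀ M → N ≤ M → ∣ s M - r ∣ <ℚ δ)

-- two rational sequences (here: partial sums of two convergent series)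
-- have the same limit: their difference tends to 0
SameLimit : (ℕ → ℚ) → (ℕ → ℚ) → Set
SameLimit s t = ∀ (δ : ℚ) → 0ℚ <ℚ δ → ∃[ N ] (∀ M → N ≤ M → ∣ s M - t M ∣ <ℚ δ)

SumIsRational : (q : ℕ → ℕ) → IsBase q → (ℕ → ℕ) → Set
SumIsRational q hq e = ∃[ r ] ConvergesTo (tailSum q hq e 0) r

PeriodicTail : (q : ℕ → ℕ) → IsBase q → (ℕ → ℕ) → ℕ → ℕ → Set
PeriodicTail q hq e n m =
  SameLimit (tailSum q hq e n)
            (λ M → (+ qprod q n m / 1) *ℚ tailSum q hq e (n + m) M)

{-# OPTIONS --safe #-}
-- Let s N be the N-th partial sum and Q N = q₁⋯q_N. Then s N = A / Q N for a natural number A,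
-- and the digit bound ε_k < q_k gives 0 ≤ s (K + M) − s K ≤ 1 / Q K.
-- If s N → p / d, then d · Q K · (p / d − s K) is an integer in [0, d]; by the pigeonhole principle
-- it takes the same value at two indices n < n + m, and that equality says that the tail after n
-- is q_{n+1}⋯q_{n+m} times the tail after n + m.
-- Conversely, if the tail after n is P = q_{n+1}⋯q_{n+m} ≥ 2 times the tail after n + m, then the
-- partial sums converge to s (n + m) + (s (n + m) − s n) / (P − 1).
module Submission where

open import Defs
open import Data.Nat as ℕ using (ℕ; zero; suc; _+_; _*_; _≤_; _<_; NonZero; s≤s; z≤n)
import Data.Nat.Properties as ℕP
open import Data.Nat.Tactic.RingSolver using (solve-∀)
open import Data.Integer as ℤ using (ℤ; +_)
import Data.Integer.Properties as ℤP
open import Data.Integer.Tactic.RingSolver using () renaming (solve-∀ to ℤ-solve-∀)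
import Data.Rational.Unnormalised as ℚᵘ
import Data.Rational.Unnormalised.Properties as ℚᵘP
open import Data.Rational as ℚ using (ℚ; _/_; 0ℚ; 1ℚ; ∣_∣; toℚᵘ)
import Data.Rational.Properties as ℚP
open import Data.Rational.Solver using (module +-*-Solver)
open import Data.Fin as Fin using (Fin)
import Data.Fin.Properties as FinP
open import Data.Product using (_,_; _×_; ∃₂; ∃-syntax)
open import Data.Sum using (inj₁; inj₂)
open import Data.Empty using (⊥-elim)
open import Relation.Nullary using (yes; no)
open import Relation.Binary.PropositionalEquality
open import Function.Bundles using (_⇔_; mk⇔)

private
  toℚᵘ-/ : ∀ i n .{{_ : NonZero n}} → toℚᵘ (i / n) ℚᵘ.≃ (i ℚᵘ./ n)
  toℚᵘ-/ i (suc n) = ℚP.toℚᵘ-fromℚᵘ (ℚᵘ.mkℚᵘ i n)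

*≤*⇒/≤/ : ∀ i j n m .{{_ : NonZero n}} .{{_ : NonZero m}} → i ℤ.* + m ℤ.≤ j ℤ.* + n → i / n ℚ.≤ j / m
*≤*⇒/≤/ i j n@(suc _) m@(suc _) h = ℚP.toℚᵘ-cancel-≤
  (ℚᵘP.≤-respˡ-≃ (ℚᵘP.≃-sym (toℚᵘ-/ i n)) (ℚᵘP.≤-respʳ-≃ (ℚᵘP.≃-sym (toℚᵘ-/ j m)) (ℚᵘ.*≤* h)))

/≤/⇒*≤* : ∀ i j n m .{{_ : NonZero n}} .{{_ : NonZero m}} → i / n ℚ.≤ j / m → i ℤ.* + m ℤ.≤ j ℤ.* + n
/≤/⇒*≤* i j n@(suc _) m@(suc _) h
  with ℚᵘP.≤-respˡ-≃ (toℚᵘ-/ i n) (ℚᵘP.≤-respʳ-≃ (toℚᵘ-/ j m) (ℚP.toℚᵘ-mono-≤ h))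
... | ℚᵘ.*≤* h′ = h′

*<*⇒/</ : ∀ i j n m .{{_ : NonZero n}} .{{_ : NonZero m}} → i ℤ.* + m ℤ.< j ℤ.* + n → i / n ℚ.< j / m
*<*⇒/</ i j n@(suc _) m@(suc _) h = ℚP.toℚᵘ-cancel-<
  (ℚᵘP.<-respˡ-≃ (ℚᵘP.≃-sym (toℚᵘ-/ i n)) (ℚᵘP.<-respʳ-≃ (ℚᵘP.≃-sym (toℚᵘ-/ j m)) (ℚᵘ.*<* h)))

*≡*⇒/≡/ : ∀ i j n m .{{_ : NonZero n}} .{{_ : NonZero m}} → i ℤ.* + m ≡ j ℤ.* + n → i / n ≡ j / m
*≡*⇒/≡/ i j n@(suc _) m@(suc _) h = ℚP.toℚᵘ-injective
  (ℚᵘP.≃-trans (toℚᵘ-/ i n) (ℚᵘP.≃-trans (ℚᵘ.*≡* h) (ℚᵘP.≃-sym (toℚᵘ-/ j m))))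

/+/≡ : ∀ i j n m .{{_ : NonZero n}} .{{_ : NonZero m}} .{{_ : NonZero (n * m)}} →
       (i / n) ℚ.+ (j / m) ≡ (i ℤ.* + m ℤ.+ j ℤ.* + n) / (n * m)
/+/≡ i j n@(suc _) m@(suc _) = ℚP.toℚᵘ-injective (ℚᵘP.≃-trans (ℚP.toℚᵘ-homo-+ (i / n) (j / m))
  (ℚᵘP.≃-trans (ℚᵘP.+-cong (toℚᵘ-/ i n) (toℚᵘ-/ j m)) (ℚᵘP.≃-sym (toℚᵘ-/ _ (n * m)))))

/*/≡ : ∀ i j n m .{{_ : NonZero n}} .{{_ : NonZero m}} .{{_ : NonZero (n * m)}} →
       (i / n) ℚ.* (j / m) ≡ (i ℤ.* j) / (n * m)
/*/≡ i j n@(suc _) m@(suc _) = ℚP.toℚᵘ-injective (ℚᵘP.≃-trans (ℚP.toℚᵘ-homo-* (i / n) (j / m))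
  (ℚᵘP.≃-trans (ℚᵘP.*-cong (toℚᵘ-/ i n) (toℚᵘ-/ j m)) (ℚᵘP.≃-sym (toℚᵘ-/ _ (n * m)))))

-/≡ : ∀ i n .{{_ : NonZero n}} → ℚ.- (i / n) ≡ (ℤ.- i) / n
-/≡ i n@(suc _) = ℚP.toℚᵘ-injective (ℚᵘP.≃-trans (ℚP.toℚᵘ-homo‿- (i / n))
  (ℚᵘP.≃-trans (ℚᵘP.-‿cong (toℚᵘ-/ i n)) (ℚᵘP.≃-sym (toℚᵘ-/ _ n))))

*≤*⇒+/≤+/ : ∀ a b n m .{{_ : NonZero n}} .{{_ : NonZero m}} → a * m ≤ b * n → + a / n ℚ.≤ + b / m
*≤*⇒+/≤+/ a b n m h = *≤*⇒/≤/ (+ a) (+ b) n m (subst₂ ℤ._≤_ (ℤP.pos-* a m) (ℤP.pos-* b n) (ℤ.+≤+ h))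

*≡*⇒+/≡+/ : ∀ a b n m .{{_ : NonZero n}} .{{_ : NonZero m}} → a * m ≡ b * n → + a / n ≡ + b / m
*≡*⇒+/≡+/ a b n m h = *≡*⇒/≡/ (+ a) (+ b) n m (trans (sym (ℤP.pos-* a m)) (trans (cong +_ h) (ℤP.pos-* b n)))

+/++/≡ : ∀ a b n m .{{_ : NonZero n}} .{{_ : NonZero m}} .{{_ : NonZero (n * m)}} →
         (+ a / n) ℚ.+ (+ b / m) ≡ + (a * m + b * n) / (n * m)
+/++/≡ a b n m = trans (/+/≡ (+ a) (+ b) n m)
  (cong (_/ (n * m)) (trans (cong₂ ℤ._+_ (sym (ℤP.pos-* a m)) (sym (ℤP.pos-* b n))) (sym (ℤP.pos-+ (a * m) (b * n)))))

+/*+/≡ : ∀ a b n m .{{_ : NonZero n}} .{{_ : NonZero m}} .{{_ : NonZero (n * m)}} →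
         (+ a / n) ℚ.* (+ b / m) ≡ + (a * b) / (n * m)
+/*+/≡ a b n m = trans (/*/≡ (+ a) (+ b) n m) (cong (_/ (n * m)) (sym (ℤP.pos-* a b)))

1+k*1/k≡1+1/k : ∀ k .{{_ : NonZero k}} → (+ suc k / 1) ℚ.* (+ 1 / k) ≡ 1ℚ ℚ.+ + 1 / k
1+k*1/k≡1+1/k k = begin
  (+ suc k / 1) ℚ.* (+ 1 / k)
    ≡⟨ +/*+/≡ (suc k) 1 1 k ⟩
  + (suc k * 1) / (1 * k)
    ≡⟨ *≡*⇒+/≡+/ (suc k * 1) (1 * k + 1 * 1) (1 * k) (1 * k) (cong (_* (1 * k)) (cross k)) ⟩
  + (1 * k + 1 * 1) / (1 * k)
    ≡⟨ +/++/≡ 1 1 1 k ⟨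
  (+ 1 / 1) ℚ.+ (+ 1 / k)       ∎
  where
  open ≡-Reasoning
  instance _ = ℕP.m*n≢0 1 k
  cross : ∀ k → suc k * 1 ≡ 1 * k + 1 * 1
  cross = solve-∀

bounded-sequence-repeats : ∀ (f : ℕ → ℕ) d → (∀ K → f K ≤ d) → ∃[ i ] ∃[ m ] (1 ≤ m × f i ≡ f (i + m))
bounded-sequence-repeats f d f≤d = repeat (FinP.pigeonhole (ℕP.n<1+n (suc d)) f′)
  where
  f′ : Fin (suc (suc d)) → Fin (suc d)
  f′ i = Fin.fromℕ< (s≤s (f≤d (Fin.toℕ i)))
  repeat : (∃₂ λ i j → i Fin.< j × f′ i ≡ f′ j) → ∃[ i ] ∃[ m ] (1 ≤ m × f i ≡ f (i + m))
  repeat (i , j , i<j , f′i≡f′j) = Fin.toℕ i , Fin.toℕ j ℕ.∸ Fin.toℕ i , ℕP.m<n⇒0<n∸m i<j , fi≡fj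
    where
    fi≡fj : f (Fin.toℕ i) ≡ f (Fin.toℕ i + (Fin.toℕ j ℕ.∸ Fin.toℕ i))
    fi≡fj = begin
      f (Fin.toℕ i)       ≡⟨ FinP.toℕ-fromℕ< _ ⟨
      Fin.toℕ (f′ i)      ≡⟨ cong Fin.toℕ f′i≡f′j ⟩
      Fin.toℕ (f′ j)      ≡⟨ FinP.toℕ-fromℕ< _ ⟩
      f (Fin.toℕ j)       ≡⟨ cong f (ℕP.m+[n∸m]≡n (ℕP.<⇒≤ i<j)) ⟨
      f (Fin.toℕ i + (Fin.toℕ j ℕ.∸ Fin.toℕ i)) ∎
      where open ≡-Reasoning

private
  p≤q⇒0≤q-p : ∀ {p q} → p ℚ.≤ q → 0ℚ ℚ.≤ q ℚ.- p
  p≤q⇒0≤q-p {p} {q} h = subst (ℚ._≤ q ℚ.- p) (ℚP.+-inverseʳ p) (ℚP.+-monoˡ-≤ (ℚ.- p) h)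

  p<q⇒0<q-p : ∀ {p q} → p ℚ.< q → 0ℚ ℚ.< q ℚ.- p
  p<q⇒0<q-p {p} {q} h = subst (ℚ._< q ℚ.- p) (ℚP.+-inverseʳ p) (ℚP.+-monoˡ-< (ℚ.- p) h)

  p≤∣p∣ : ∀ p → p ℚ.≤ ∣ p ∣
  p≤∣p∣ p with ℚP.≤-total 0ℚ p
  ... | inj₁ 0≤p = ℚP.≤-reflexive (sym (ℚP.0≤p⇒∣p∣≡p 0≤p))
  ... | inj₂ p≤0 = ℚP.≤-trans p≤0 (ℚP.0≤∣p∣ p)

  -p≤∣p∣ : ∀ p → ℚ.- p ℚ.≤ ∣ p ∣
  -p≤∣p∣ p = subst (ℚ.- p ℚ.≤_) (ℚP.∣-p∣≡∣p∣ p) (p≤∣p∣ (ℚ.- p))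

  ½ : ℚ → ℚ
  ½ δ = δ ℚ.* ℚ.½

  ½-pos : ∀ {δ} → 0ℚ ℚ.< δ → 0ℚ ℚ.< ½ δ
  ½-pos {δ} δ>0 = ℚP.positive⁻¹ (½ δ) {{ℚP.pos*pos⇒pos δ {{ℚ.positive δ>0}} ℚ.½}}

-- ConvergesTo s r and SameLimit s t unfold to TendsToZero of the pointwise differences.
TendsToZero : (ℕ → ℚ) → Set
TendsToZero u = ∀ δ → 0ℚ ℚ.< δ → ∃[ N ] (∀ M → N ≤ M → ∣ u M ∣ ℚ.< δ)

tendsToZero-≤ : ∀ {u v : ℕ → ℚ} N₀ → (∀ M → N₀ ≤ M → ∣ u M ∣ ℚ.≤ v M) →
                TendsToZero v → TendsToZero u
tendsToZero-≤ {u} {v} N₀ u≤v v→0 δ δ>0 with v→0 δ δ>0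
... | N , ∣v∣<δ = N ℕ.⊔ N₀ , λ M N⊔N₀≤M →
  ℚP.≤-<-trans (ℚP.≤-trans (u≤v M (ℕP.≤-trans (ℕP.m≤n⊔m N N₀) N⊔N₀≤M)) (p≤∣p∣ (v M)))
               (∣v∣<δ M (ℕP.≤-trans (ℕP.m≤m⊔n N N₀) N⊔N₀≤M))

tendsToZero-∣∣ : ∀ {u : ℕ → ℚ} → TendsToZero u → TendsToZero (λ M → ∣ u M ∣)
tendsToZero-∣∣ {u} u→0 δ δ>0 with u→0 δ δ>0
... | N , ∣u∣<δ = N , λ M N≤M → subst (ℚ._< δ) (sym (ℚP.∣∣p∣∣≡∣p∣ (u M))) (∣u∣<δ M N≤M)

tendsToZero-cong : ∀ {u v : ℕ → ℚ} → (∀ M → u M ≡ v M) → TendsToZero u → TendsToZero v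
tendsToZero-cong u≡v u→0 =
  tendsToZero-≤ 0 (λ M _ → ℚP.≤-reflexive (cong ∣_∣ (sym (u≡v M)))) (tendsToZero-∣∣ u→0)

tendsToZero-+ : ∀ {u v : ℕ → ℚ} → TendsToZero u → TendsToZero v → TendsToZero (λ M → u M ℚ.+ v M)
tendsToZero-+ {u} {v} u→0 v→0 δ δ>0 with u→0 (½ δ) (½-pos δ>0) | v→0 (½ δ) (½-pos δ>0)
... | N₁ , ∣u∣<½δ | N₂ , ∣v∣<½δ = N₁ ℕ.⊔ N₂ , λ M N≤M →
  ℚP.≤-<-trans (ℚP.∣p+q∣≤∣p∣+∣q∣ (u M) (v M))
    (subst (_ ℚ.<_) (½δ+½δ≡δ δ)
      (ℚP.+-mono-< (∣u∣<½δ M (ℕP.≤-trans (ℕP.m≤m⊔n N₁ N₂) N≤M))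
                   (∣v∣<½δ M (ℕP.≤-trans (ℕP.m≤n⊔m N₁ N₂) N≤M))))
  where
  ½δ+½δ≡δ : ∀ δ → ½ δ ℚ.+ ½ δ ≡ δ
  ½δ+½δ≡δ = solve 1 (λ δ → δ :* con ℚ.½ :+ δ :* con ℚ.½ := δ) refl
    where open +-*-Solver

tendsToZero-shift : ∀ {u : ℕ → ℚ} k → TendsToZero u → TendsToZero (λ M → u (k + M))
tendsToZero-shift {u} k u→0 δ δ>0 with u→0 δ δ>0
... | N , ∣u∣<δ = N , λ M N≤M → ∣u∣<δ (k + M) (ℕP.≤-trans N≤M (ℕP.m≤n+m M k))

tendsToZero-unshift : ∀ {u : ℕ → ℚ} k → TendsToZero (λ M → u (k + M)) → TendsToZero u
tendsToZero-unshift {u} k u→0 δ δ>0 with u→0 δ δ>0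
... | N , ∣u∣<δ = k + N , λ M k+N≤M →
  subst (λ i → ∣ u i ∣ ℚ.< δ) (ℕP.m+[n∸m]≡n (ℕP.≤-trans (ℕP.m≤m+n k N) k+N≤M))
        (∣u∣<δ (M ℕ.∸ k) (subst (ℕ._≤ M ℕ.∸ k) (ℕP.m+n∸m≡n k N) (ℕP.∸-monoˡ-≤ k k+N≤M)))

tendsToZero-scale : ∀ {u : ℕ → ℚ} k → TendsToZero u → TendsToZero (λ M → (+ k / 1) ℚ.* u M)
tendsToZero-scale {u} zero u→0 =
  tendsToZero-≤ 0 (λ M _ → subst (ℚ._≤ ∣ u M ∣) (sym (cong ∣_∣ (ℚP.*-zeroˡ (u M)))) (ℚP.0≤∣p∣ (u M)))
                  (tendsToZero-∣∣ u→0)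
tendsToZero-scale {u} (suc k) u→0 =
  tendsToZero-cong (λ M → sym (1+k*x≡k*x+x (u M))) (tendsToZero-+ (tendsToZero-scale k u→0) u→0)
  where
  1+k≡k+1 : + suc k / 1 ≡ (+ k / 1) ℚ.+ 1ℚ
  1+k≡k+1 = sym (trans (+/++/≡ k 1 1 1) (*≡*⇒+/≡+/ (k * 1 + 1 * 1) (suc k) 1 1 (cross k)))
    where
    cross : ∀ k → (k * 1 + 1 * 1) * 1 ≡ (1 + k) * 1
    cross = solve-∀
  1+k*x≡k*x+x : ∀ x → (+ suc k / 1) ℚ.* x ≡ (+ k / 1) ℚ.* x ℚ.+ x
  1+k*x≡k*x+x x = trans (cong (ℚ._* x) 1+k≡k+1)
                    (trans (ℚP.*-distribʳ-+ x (+ k / 1) 1ℚ) (cong ((+ k / 1) ℚ.* x ℚ.+_) (ℚP.*-identityˡ x)))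

1/suc-tendsToZero : TendsToZero (λ M → + 1 / suc M)
1/suc-tendsToZero δ δ>0 with ℚ.positive δ>0
1/suc-tendsToZero δ@(ℚ.mkℚ ℤ.+[1+ a ] b-1 _) δ>0 | _ = suc b-1 , λ M b≤M →
  subst (ℚ._< δ) (sym (ℚP.0≤p⇒∣p∣≡p (0≤1/suc M)))
    (subst (+ 1 / suc M ℚ.<_) (ℚP.↥p/↧p≡p δ)
      (*<*⇒/</ (+ 1) ℤ.+[1+ a ] (suc M) (suc b-1)
        (subst₂ ℤ._<_ (ℤP.pos-* 1 (suc b-1)) (ℤP.pos-* (suc a) (suc M)) (ℤ.+<+ (b<[1+a]*[1+M] M b≤M)))))
  where
  0≤1/suc : ∀ M → 0ℚ ℚ.≤ + 1 / suc M
  0≤1/suc M = *≤*⇒+/≤+/ 0 1 1 (suc M) z≤n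
  b<[1+a]*[1+M] : ∀ M → suc b-1 ≤ M → 1 * suc b-1 < suc a * suc M
  b<[1+a]*[1+M] M b≤M = ℕP.≤-trans (s≤s (ℕP.≤-trans (ℕP.≤-reflexive (ℕP.*-identityˡ (suc b-1))) b≤M))
                                    (ℕP.m≤m+n (suc M) (a * suc M))

≤-limit : ∀ {u : ℕ → ℚ} {r a} N₀ → (∀ M → a ℚ.≤ u (N₀ + M)) → ConvergesTo u r → a ℚ.≤ r
≤-limit {u} {r} {a} N₀ a≤u u→r with a ℚ.≤? r
... | yes a≤r = a≤r
... | no a≰r with u→r (a ℚ.- r) (p<q⇒0<q-p (ℚP.≰⇒> a≰r))
...   | N , ∣u-r∣<a-r = ⊥-elim (ℚP.<-irrefl refl (ℚP.≤-<-trans a-r≤u-r u-r<a-r))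
  where
  a-r≤u-r : a ℚ.- r ℚ.≤ u (N₀ + N) ℚ.- r
  a-r≤u-r = ℚP.+-monoˡ-≤ (ℚ.- r) (a≤u N)
  u-r<a-r : u (N₀ + N) ℚ.- r ℚ.< a ℚ.- r
  u-r<a-r = ℚP.≤-<-trans (p≤∣p∣ _) (∣u-r∣<a-r (N₀ + N) (ℕP.m≤n+m N N₀))

limit-≤ : ∀ {u : ℕ → ℚ} {r b} N₀ → (∀ M → u (N₀ + M) ℚ.≤ b) → ConvergesTo u r → r ℚ.≤ b
limit-≤ {u} {r} {b} N₀ u≤b u→r with r ℚ.≤? b
... | yes r≤b = r≤b
... | no r≰b with u→r (r ℚ.- b) (p<q⇒0<q-p (ℚP.≰⇒> r≰b))
...   | N , ∣u-r∣<r-b = ⊥-elim (ℚP.<-irrefl refl (ℚP.≤-<-trans r-b≤r-u r-u<r-b))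
  where
  r-b≤r-u : r ℚ.- b ℚ.≤ ℚ.- (u (N₀ + N) ℚ.- r)
  r-b≤r-u = subst (r ℚ.- b ℚ.≤_) (r-x≡-[x-r] r (u (N₀ + N))) (ℚP.+-monoʳ-≤ r (ℚP.neg-antimono-≤ (u≤b N)))
    where
    r-x≡-[x-r] : ∀ r x → r ℚ.- x ≡ ℚ.- (x ℚ.- r)
    r-x≡-[x-r] = solve 2 (λ r x → r :- x := :- (x :- r)) refl
      where open +-*-Solver
  r-u<r-b : ℚ.- (u (N₀ + N) ℚ.- r) ℚ.< r ℚ.- b
  r-u<r-b = ℚP.≤-<-trans (-p≤∣p∣ _) (∣u-r∣<r-b (N₀ + N) (ℕP.m≤n+m N N₀))

module _ (s : ℕ → ℚ) where

  limit⇒periodic-increments : ∀ {r} a b k → ConvergesTo s r →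
    r ℚ.- s a ≡ (+ k / 1) ℚ.* (r ℚ.- s b) →
    TendsToZero (λ M → (s (a + M) ℚ.- s a) ℚ.- (+ k / 1) ℚ.* (s (b + M) ℚ.- s b))
  limit⇒periodic-increments {r} a b k s→r r-sa≡P[r-sb] =
    tendsToZero-≤ 0 (λ M _ → subst (ℚ._≤ ∣ s (a + M) ℚ.- r ∣ ℚ.+ ∣ P ℚ.* (s (b + M) ℚ.- r) ∣)
                              (sym (cong ∣_∣ (increment≡ M)))
                              (ℚP.∣p-q∣≤∣p∣+∣q∣ (s (a + M) ℚ.- r) (P ℚ.* (s (b + M) ℚ.- r))))
      (tendsToZero-+ (tendsToZero-∣∣ (tendsToZero-shift a s→r))
                     (tendsToZero-∣∣ (tendsToZero-scale k (tendsToZero-shift b s→r))))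
    where
    P : ℚ
    P = + k / 1
    increment≡ : ∀ M → (s (a + M) ℚ.- s a) ℚ.- P ℚ.* (s (b + M) ℚ.- s b)
                     ≡ (s (a + M) ℚ.- r) ℚ.- P ℚ.* (s (b + M) ℚ.- r)
    increment≡ M = begin
      (X ℚ.- s a) ℚ.- P ℚ.* (Y ℚ.- s b)
        ≡⟨ regroup X Y (s a) (s b) P r ⟩
      L ℚ.+ ((r ℚ.- s a) ℚ.- P ℚ.* (r ℚ.- s b))
        ≡⟨ cong (λ w → L ℚ.+ (w ℚ.- P ℚ.* (r ℚ.- s b))) r-sa≡P[r-sb] ⟩
      L ℚ.+ (P ℚ.* (r ℚ.- s b) ℚ.- P ℚ.* (r ℚ.- s b))
        ≡⟨ trans (cong (L ℚ.+_) (ℚP.+-inverseʳ (P ℚ.* (r ℚ.- s b)))) (ℚP.+-identityʳ L) ⟩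
      L ∎
      where
      open ≡-Reasoning
      X Y L : ℚ
      X = s (a + M)
      Y = s (b + M)
      L = (X ℚ.- r) ℚ.- P ℚ.* (Y ℚ.- r)
      regroup : ∀ X Y sa sb P r → (X ℚ.- sa) ℚ.- P ℚ.* (Y ℚ.- sb) ≡
                ((X ℚ.- r) ℚ.- P ℚ.* (Y ℚ.- r)) ℚ.+ ((r ℚ.- sa) ℚ.- P ℚ.* (r ℚ.- sb))
      regroup = solve 6 (λ X Y sa sb P r → (X :- sa) :- P :* (Y :- sb) :=
                  ((X :- r) :- P :* (Y :- r)) :+ ((r :- sa) :- P :* (r :- sb))) refl
        where open +-*-Solver

  -- With r := b + (b − a) c, the hypothesis P c = 1 + c turns s (n+m+M) − r into − c (E M + D M).
  periodic-increments⇒limit : ∀ n m (P c : ℚ) → P ℚ.* c ≡ 1ℚ ℚ.+ c → 0ℚ ℚ.≤ c → c ℚ.≤ 1ℚ →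
    TendsToZero (λ M → s (n + m + M) ℚ.- s (n + M)) →
    TendsToZero (λ M → (s (n + M) ℚ.- s n) ℚ.- P ℚ.* (s (n + m + M) ℚ.- s (n + m))) →
    ConvergesTo s (s (n + m) ℚ.+ (s (n + m) ℚ.- s n) ℚ.* c)
  periodic-increments⇒limit n m P c Pc≡1+c 0≤c c≤1 E→0 D→0 =
    tendsToZero-unshift (n + m)
      (tendsToZero-≤ 0 (λ M _ → bound M) (tendsToZero-+ (tendsToZero-∣∣ E→0) (tendsToZero-∣∣ D→0)))
    where
    a b r : ℚ
    a = s n
    b = s (n + m)
    r = b ℚ.+ (b ℚ.- a) ℚ.* c
    E D : ℕ → ℚ
    E M = s (n + m + M) ℚ.- s (n + M)
    D M = (s (n + M) ℚ.- a) ℚ.- P ℚ.* (s (n + m + M) ℚ.- b)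
    distance≡ : ∀ M → s (n + m + M) ℚ.- r ≡ ℚ.- (c ℚ.* (E M ℚ.+ D M))
    distance≡ M = begin
      X ℚ.- r
        ≡⟨ regroup X Y a b P c ⟩
      L ℚ.+ (P ℚ.* c ℚ.- (1ℚ ℚ.+ c)) ℚ.* (b ℚ.- X)
        ≡⟨ cong (λ w → L ℚ.+ (w ℚ.- (1ℚ ℚ.+ c)) ℚ.* (b ℚ.- X)) Pc≡1+c ⟩
      L ℚ.+ ((1ℚ ℚ.+ c) ℚ.- (1ℚ ℚ.+ c)) ℚ.* (b ℚ.- X)
        ≡⟨ cong (λ w → L ℚ.+ w ℚ.* (b ℚ.- X)) (ℚP.+-inverseʳ (1ℚ ℚ.+ c)) ⟩
      L ℚ.+ 0ℚ ℚ.* (b ℚ.- X)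
        ≡⟨ trans (cong (L ℚ.+_) (ℚP.*-zeroˡ (b ℚ.- X))) (ℚP.+-identityʳ L) ⟩
      L ∎
      where
      open ≡-Reasoning
      X Y L : ℚ
      X = s (n + m + M)
      Y = s (n + M)
      L = ℚ.- (c ℚ.* (E M ℚ.+ D M))
      regroup : ∀ X Y a b P c → X ℚ.- (b ℚ.+ (b ℚ.- a) ℚ.* c) ≡
        ℚ.- (c ℚ.* ((X ℚ.- Y) ℚ.+ ((Y ℚ.- a) ℚ.- P ℚ.* (X ℚ.- b)))) ℚ.+ (P ℚ.* c ℚ.- (1ℚ ℚ.+ c)) ℚ.* (b ℚ.- X)
      regroup = solve 6 (λ X Y a b P c → X :- (b :+ (b :- a) :* c) :=
        :- (c :* ((X :- Y) :+ ((Y :- a) :- P :* (X :- b)))) :+ (P :* c :- (con 1ℚ :+ c)) :* (b :- X)) refl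
        where open +-*-Solver
    bound : ∀ M → ∣ s (n + m + M) ℚ.- r ∣ ℚ.≤ ∣ E M ∣ ℚ.+ ∣ D M ∣
    bound M = begin
      ∣ s (n + m + M) ℚ.- r ∣       ≡⟨ cong ∣_∣ (distance≡ M) ⟩
      ∣ ℚ.- (c ℚ.* (E M ℚ.+ D M)) ∣ ≡⟨ ℚP.∣-p∣≡∣p∣ _ ⟩
      ∣ c ℚ.* (E M ℚ.+ D M) ∣       ≡⟨ ℚP.∣p*q∣≡∣p∣*∣q∣ c _ ⟩
      ∣ c ∣ ℚ.* ∣ E M ℚ.+ D M ∣     ≡⟨ cong (ℚ._* ∣ E M ℚ.+ D M ∣) (ℚP.0≤p⇒∣p∣≡p 0≤c) ⟩
      c ℚ.* ∣ E M ℚ.+ D M ∣         ≤⟨ ℚP.*-monoʳ-≤-nonNeg _ {{ℚP.∣-∣-nonNeg (E M ℚ.+ D M)}} c≤1 ⟩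
      1ℚ ℚ.* ∣ E M ℚ.+ D M ∣      ≡⟨ ℚP.*-identityˡ _ ⟩
      ∣ E M ℚ.+ D M ∣               ≤⟨ ℚP.∣p+q∣≤∣p∣+∣q∣ (E M) (D M) ⟩
      ∣ E M ∣ ℚ.+ ∣ D M ∣           ∎
      where open ℚP.≤-Reasoning

module _ (q : ℕ → ℕ) where

  qprod-+ : ∀ a k l → qprod q a (k + l) ≡ qprod q a k * qprod q (a + k) l
  qprod-+ a k zero = trans (cong (qprod q a) (ℕP.+-identityʳ k)) (sym (ℕP.*-identityʳ _))
  qprod-+ a k (suc l) = begin
    qprod q a (k + suc l)                                ≡⟨ cong (qprod q a) (ℕP.+-suc k l) ⟩
    qprod q a (k + l) * q (a + suc (k + l))              ≡⟨ cong₂ _*_ (qprod-+ a k l) (cong q index≡) ⟩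
    qprod q a k * qprod q (a + k) l * q (a + k + suc l)  ≡⟨ ℕP.*-assoc (qprod q a k) _ _ ⟩
    qprod q a k * qprod q (a + k) (suc l)                ∎
    where
    open ≡-Reasoning
    index≡ : a + suc (k + l) ≡ a + k + suc l
    index≡ = trans (cong (λ i → a + i) (sym (ℕP.+-suc k l))) (sym (ℕP.+-assoc a k (suc l)))

  qprod-≥ : IsBase q → ∀ a l → suc l ≤ qprod q a l
  qprod-≥ hq a zero = ℕP.≤-refl
  qprod-≥ hq a (suc l) = ℕP.≤-trans (s≤s (s≤s (ℕP.m≤m*n l 2)))
                           (ℕP.*-mono-≤ (qprod-≥ hq a l) (hq (a + suc l) 1≤a+1+l))
    where
    1≤a+1+l : 1 ≤ a + suc l
    1≤a+1+l = ℕP.≤-trans (s≤s z≤n) (ℕP.m≤n+m (suc l) a)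

module CantorSeries (q : ℕ → ℕ) (hq : IsBase q) (e : ℕ → ℕ) where

  Q : ℕ → ℕ
  Q = qprod q 0

  Q-nonZero : ∀ k → NonZero (Q k)
  Q-nonZero = qprod-nz q hq 0

  infixl 7 _/Q_
  _/Q_ : ℕ → ℕ → ℚ
  a /Q k = _/_ (+ a) (Q k) {{Q-nonZero k}}

  s : ℕ → ℚ
  s = tailSum q hq e 0

  numerator : ℕ → ℕ
  numerator zero = 0
  numerator (suc N) = numerator N * q (suc N) + e (suc N)

  s≡numerator/Q : ∀ N → s N ≡ numerator N /Q N
  s≡numerator/Q zero = refl
  s≡numerator/Q (suc N) = begin
    s N ℚ.+ + ε / Q′
      ≡⟨ cong (ℚ._+ + ε / Q′) (s≡numerator/Q N) ⟩
    + a / Q N ℚ.+ + ε / Q′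
      ≡⟨ +/++/≡ a ε (Q N) Q′ ⟩
    + (a * Q′ + ε * Q N) / (Q N * Q′)
      ≡⟨ *≡*⇒+/≡+/ (a * Q′ + ε * Q N) (numerator (suc N)) (Q N * Q′) Q′ (cross a (Q N) (q (suc N)) ε) ⟩
    + numerator (suc N) / Q′ ∎
    where
    open ≡-Reasoning
    a = numerator N
    ε = e (suc N)
    Q′ = Q (suc N)
    instance
      _ = Q-nonZero N
      _ = Q-nonZero (suc N)
      _ = ℕP.m*n≢0 (Q N) Q′
    cross : ∀ a Q c ε → (a * (Q * c) + ε * Q) * (Q * c) ≡ (a * c + ε) * (Q * (Q * c))
    cross = solve-∀

  tailSum≡ : ∀ n M → tailSum q hq e n M ≡ s (n + M) ℚ.- s n
  tailSum≡ n zero = trans (sym (ℚP.+-inverseʳ (s n))) (cong (λ k → s k ℚ.- s n) (sym (ℕP.+-identityʳ n)))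
  tailSum≡ n (suc M) = begin
    tailSum q hq e n M ℚ.+ t (n + suc M)       ≡⟨ cong (ℚ._+ t (n + suc M)) (tailSum≡ n M) ⟩
    (s (n + M) ℚ.- s n) ℚ.+ t (n + suc M)      ≡⟨ regroup (s (n + M)) (s n) (t (n + suc M)) ⟩
    (s (n + M) ℚ.+ t (n + suc M)) ℚ.- s n      ≡⟨ cong (λ k → (s (n + M) ℚ.+ t k) ℚ.- s n) (ℕP.+-suc n M) ⟩
    s (suc (n + M)) ℚ.- s n                    ≡⟨ cong (λ k → s k ℚ.- s n) (sym (ℕP.+-suc n M)) ⟩
    s (n + suc M) ℚ.- s n                      ∎
    where
    open ≡-Reasoning
    t : ℕ → ℚ
    t = term q hq e
    regroup : ∀ a b t → (a ℚ.- b) ℚ.+ t ≡ (a ℚ.+ t) ℚ.- b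
    regroup = solve 3 (λ a b t → (a :- b) :+ t := (a :+ t) :- b) refl
      where open +-*-Solver

  private
    a[bc]≡[ac]b : ∀ a b c → a * (b * c) ≡ a * c * b
    a[bc]≡[ac]b = solve-∀

  module BoundedDigits (he : ∀ k → 1 ≤ k → e k < q k) where

    numerator-≥ : ∀ n M → numerator n * qprod q n M ≤ numerator (n + M)
    numerator-≥ n zero = ℕP.≤-reflexive (trans (ℕP.*-identityʳ _) (cong numerator (sym (ℕP.+-identityʳ n))))
    numerator-≥ n (suc M) rewrite ℕP.+-suc n M = begin
      numerator n * (qprod q n M * q (suc (n + M)))   ≡⟨ sym (ℕP.*-assoc (numerator n) _ _) ⟩
      numerator n * qprod q n M * q (suc (n + M))     ≤⟨ ℕP.*-monoˡ-≤ _ (numerator-≥ n M) ⟩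
      numerator (n + M) * q (suc (n + M))             ≤⟨ ℕP.m≤m+n _ _ ⟩
      numerator (suc (n + M))                         ∎
      where open ℕP.≤-Reasoning

    numerator-< : ∀ n M → numerator (n + M) < suc (numerator n) * qprod q n M
    numerator-< n zero rewrite ℕP.+-identityʳ n | ℕP.*-identityʳ (suc (numerator n)) = ℕP.≤-refl
    numerator-< n (suc M) rewrite ℕP.+-suc n M = begin
      suc (numerator (n + M) * q′ + e (suc (n + M)))    ≡⟨ sym (ℕP.+-suc _ _) ⟩
      numerator (n + M) * q′ + suc (e (suc (n + M)))    ≤⟨ ℕP.+-monoʳ-≤ _ (he (suc (n + M)) (s≤s z≤n)) ⟩
      numerator (n + M) * q′ + q′                       ≡⟨ ℕP.+-comm _ q′ ⟩
      suc (numerator (n + M)) * q′                      ≤⟨ ℕP.*-monoˡ-≤ q′ (numerator-< n M) ⟩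
      suc (numerator n) * qprod q n M * q′              ≡⟨ ℕP.*-assoc (suc (numerator n)) (qprod q n M) q′ ⟩
      suc (numerator n) * (qprod q n M * q′)            ∎
      where
      open ℕP.≤-Reasoning
      q′ = q (suc (n + M))

    s-mono : ∀ K M → s K ℚ.≤ s (K + M)
    s-mono K M rewrite s≡numerator/Q K | s≡numerator/Q (K + M) =
      *≤*⇒+/≤+/ (numerator K) (numerator (K + M)) (Q K) (Q (K + M)) {{Q-nonZero K}} {{Q-nonZero (K + M)}} cross
      where
      open ℕP.≤-Reasoning
      cross : numerator K * Q (K + M) ≤ numerator (K + M) * Q K
      cross = begin
        numerator K * Q (K + M)                 ≡⟨ cong (numerator K *_) (qprod-+ q 0 K M) ⟩
        numerator K * (Q K * qprod q K M)       ≡⟨ a[bc]≡[ac]b (numerator K) (Q K) (qprod q K M) ⟩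
        numerator K * qprod q K M * Q K         ≤⟨ ℕP.*-monoˡ-≤ (Q K) (numerator-≥ K M) ⟩
        numerator (K + M) * Q K                 ∎

    s-bounded : ∀ K M → s (K + M) ℚ.≤ suc (numerator K) /Q K
    s-bounded K M rewrite s≡numerator/Q (K + M) =
      *≤*⇒+/≤+/ (numerator (K + M)) (suc (numerator K)) (Q (K + M)) (Q K) {{Q-nonZero (K + M)}} {{Q-nonZero K}} cross
      where
      open ℕP.≤-Reasoning
      cross : numerator (K + M) * Q K ≤ suc (numerator K) * Q (K + M)
      cross = begin
        numerator (K + M) * Q K                   ≤⟨ ℕP.*-monoˡ-≤ (Q K) (ℕP.<⇒≤ (numerator-< K M)) ⟩
        suc (numerator K) * qprod q K M * Q K     ≡⟨ sym (a[bc]≡[ac]b (suc (numerator K)) (Q K) (qprod q K M)) ⟩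
        suc (numerator K) * (Q K * qprod q K M)   ≡⟨ cong (suc (numerator K) *_) (qprod-+ q 0 K M) ⟨
        suc (numerator K) * Q (K + M)             ∎

    ∣s[K+M]-s[K]∣≤1/suc[K] : ∀ K M → ∣ s (K + M) ℚ.- s K ∣ ℚ.≤ + 1 / suc K
    ∣s[K+M]-s[K]∣≤1/suc[K] K M = begin
      ∣ s (K + M) ℚ.- s K ∣     ≡⟨ ℚP.0≤p⇒∣p∣≡p (p≤q⇒0≤q-p (s-mono K M)) ⟩
      s (K + M) ℚ.- s K         ≤⟨ ℚP.+-monoˡ-≤ (ℚ.- s K) (s-bounded K M) ⟩
      suc a /Q K ℚ.- s K        ≡⟨ cong (λ x → suc a /Q K ℚ.- x) (s≡numerator/Q K) ⟩
      suc a /Q K ℚ.- a /Q K     ≡⟨ cong (ℚ._- a /Q K) (suc/Q≡ a) ⟩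
      (a /Q K ℚ.+ 1 /Q K) ℚ.- a /Q K ≡⟨ x+y-x≡y (a /Q K) (1 /Q K) ⟩
      1 /Q K                    ≤⟨ *≤*⇒+/≤+/ 1 1 (Q K) (suc K) {{Q-nonZero K}} (ℕP.*-monoʳ-≤ 1 (qprod-≥ q hq 0 K)) ⟩
      + 1 / suc K               ∎
      where
      open ℚP.≤-Reasoning
      a = numerator K
      suc/Q≡ : ∀ a → suc a /Q K ≡ a /Q K ℚ.+ 1 /Q K
      suc/Q≡ a = sym (trans (+/++/≡ a 1 (Q K) (Q K))
                            (*≡*⇒+/≡+/ (a * Q K + 1 * Q K) (suc a) (Q K * Q K) (Q K) (cross a (Q K))))
        where
        instance
          _ = Q-nonZero K
          _ = ℕP.m*n≢0 (Q K) (Q K)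
        cross : ∀ a Q → (a * Q + 1 * Q) * Q ≡ (1 + a) * (Q * Q)
        cross = solve-∀
      x+y-x≡y : ∀ x y → (x ℚ.+ y) ℚ.- x ≡ y
      x+y-x≡y = solve 2 (λ x y → (x :+ y) :- x := y) refl
        where open +-*-Solver

    s-increments-tendToZero : ∀ n m → TendsToZero (λ M → s (n + m + M) ℚ.- s (n + M))
    s-increments-tendToZero n m = tendsToZero-≤ 0 (λ M _ → bound M) 1/suc-tendsToZero
      where
      open ℚP.≤-Reasoning
      bound : ∀ M → ∣ s (n + m + M) ℚ.- s (n + M) ∣ ℚ.≤ + 1 / suc M
      bound M = begin
        ∣ s (n + m + M) ℚ.- s (n + M) ∣   ≡⟨ cong (λ k → ∣ s k ℚ.- s (n + M) ∣) (index≡ n m M) ⟩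
        ∣ s (n + M + m) ℚ.- s (n + M) ∣   ≤⟨ ∣s[K+M]-s[K]∣≤1/suc[K] (n + M) m ⟩
        + 1 / suc (n + M)                 ≤⟨ *≤*⇒+/≤+/ 1 1 (suc (n + M)) (suc M) (ℕP.*-monoʳ-≤ 1 (s≤s (ℕP.m≤n+m M n))) ⟩
        + 1 / suc M                       ∎
        where
        index≡ : ∀ n m M → n + m + M ≡ n + M + m
        index≡ = solve-∀

    periodicTail⇒rational : ∀ n m → 1 ≤ m → PeriodicTail q hq e n m → SumIsRational q hq e
    periodicTail⇒rational n m m≥1 periodic =
      _ , periodic-increments⇒limit s n m P c P*c≡1+c 0≤c c≤1 (s-increments-tendToZero n m) D→0
      where
      G : ℕ
      G = qprod q n m
      P : ℚ
      P = + G / 1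
      G≡suc[G-1] : G ≡ suc (ℕ.pred G)
      G≡suc[G-1] = sym (ℕP.suc-pred G {{ℕ.>-nonZero (ℕP.≤-trans (s≤s z≤n) (qprod-≥ q hq n m))}})
      instance
        G-1-nonZero : NonZero (ℕ.pred G)
        G-1-nonZero = ℕ.>-nonZero (ℕP.pred-mono-≤ (ℕP.≤-trans (s≤s m≥1) (qprod-≥ q hq n m)))
      c : ℚ
      c = + 1 / ℕ.pred G
      P*c≡1+c : P ℚ.* c ≡ 1ℚ ℚ.+ c
      P*c≡1+c = subst (λ g → (+ g / 1) ℚ.* c ≡ 1ℚ ℚ.+ c) (sym G≡suc[G-1]) (1+k*1/k≡1+1/k (ℕ.pred G))
      0≤c : 0ℚ ℚ.≤ c
      0≤c = *≤*⇒+/≤+/ 0 1 1 (ℕ.pred G) z≤n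
      c≤1 : c ℚ.≤ 1ℚ
      c≤1 = *≤*⇒+/≤+/ 1 1 (ℕ.pred G) 1 (ℕP.*-monoʳ-≤ 1 (ℕ.>-nonZero⁻¹ (ℕ.pred G)))
      D→0 : TendsToZero (λ M → (s (n + M) ℚ.- s n) ℚ.- P ℚ.* (s (n + m + M) ℚ.- s (n + m)))
      D→0 = tendsToZero-cong (λ M → cong₂ (λ x y → x ℚ.- P ℚ.* y) (tailSum≡ n M) (tailSum≡ (n + m) M)) periodic

    module RationalLimit (p : ℤ) (d : ℕ) .{{d-nonZero : NonZero d}} (s→p/d : ConvergesTo s (p / d)) where

      r : ℚ
      r = p / d

      dQ-nonZero : ∀ K → NonZero (d * Q K)
      dQ-nonZero K = ℕP.m*n≢0 d (Q K) {{d-nonZero}} {{Q-nonZero K}}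

      -- d · Q K · (r − s K), an integer since r = p / d and s K = numerator K / Q K
      remainderℤ : ℕ → ℤ
      remainderℤ K = p ℤ.* + Q K ℤ.- + numerator K ℤ.* + d

      remainder : ℕ → ℕ
      remainder K = ℤ.∣ remainderℤ K ∣

      +remainder≡remainderℤ : ∀ K → + remainder K ≡ remainderℤ K
      +remainder≡remainderℤ K = ℤP.0≤i⇒+∣i∣≡i (ℤP.i≤j⇒0≤j-i numerator*d≤p*Q)
        where
        s≤r : s K ℚ.≤ r
        s≤r = ≤-limit {s} K (s-mono K) s→p/d
        numerator*d≤p*Q : + numerator K ℤ.* + d ℤ.≤ p ℤ.* + Q K
        numerator*d≤p*Q = /≤/⇒*≤* (+ numerator K) p (Q K) d {{Q-nonZero K}} (subst (ℚ._≤ r) (s≡numerator/Q K) s≤r)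

      remainder≤d : ∀ K → remainder K ≤ d
      remainder≤d K = ℤP.drop‿+≤+ (begin
        + remainder K                                     ≡⟨ +remainder≡remainderℤ K ⟩
        p ℤ.* + Q K ℤ.- + a ℤ.* + d                       ≤⟨ ℤP.+-monoˡ-≤ (ℤ.- (+ a ℤ.* + d)) p*Q≤[1+numerator]*d ⟩
        + suc a ℤ.* + d ℤ.- + a ℤ.* + d                   ≡⟨ [1+a]d-ad≡d (+ a) (+ d) ⟩
        + d                                               ∎)
        where
        open ℤP.≤-Reasoning
        a = numerator K
        r≤[1+numerator]/Q : r ℚ.≤ suc a /Q K
        r≤[1+numerator]/Q = limit-≤ {s} K (s-bounded K) s→p/d
        p*Q≤[1+numerator]*d : p ℤ.* + Q K ℤ.≤ + suc a ℤ.* + d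
        p*Q≤[1+numerator]*d = /≤/⇒*≤* p (+ suc a) d (Q K) {{d-nonZero}} {{Q-nonZero K}} r≤[1+numerator]/Q
        [1+a]d-ad≡d : ∀ a d → (+ 1 ℤ.+ a) ℤ.* d ℤ.- a ℤ.* d ≡ d
        [1+a]d-ad≡d = ℤ-solve-∀

      r-s≡remainder/dQ : ∀ K → r ℚ.- s K ≡ _/_ (+ remainder K) (d * Q K) {{dQ-nonZero K}}
      r-s≡remainder/dQ K = begin
        r ℚ.- s K                                 ≡⟨ cong (λ x → r ℚ.- x) (s≡numerator/Q K) ⟩
        r ℚ.- (+ a / Q K)                         ≡⟨ cong (r ℚ.+_) (-/≡ (+ a) (Q K)) ⟩
        r ℚ.+ (ℤ.- + a) / Q K                     ≡⟨ /+/≡ p (ℤ.- + a) d (Q K) ⟩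
        (p ℤ.* + Q K ℤ.+ (ℤ.- + a) ℤ.* + d) / (d * Q K)
                                                  ≡⟨ cong (λ i → (p ℤ.* + Q K ℤ.+ i) / (d * Q K)) (ℤP.neg-distribˡ-* (+ a) (+ d)) ⟨
        remainderℤ K / (d * Q K)                  ≡⟨ cong (_/ (d * Q K)) (+remainder≡remainderℤ K) ⟨
        + remainder K / (d * Q K)                 ∎
        where
        open ≡-Reasoning
        a = numerator K
        instance
          _ = Q-nonZero K
          _ = dQ-nonZero K

      equal-remainders⇒tail-ratio : ∀ a m → remainder a ≡ remainder (a + m) →
                           r ℚ.- s a ≡ (+ qprod q a m / 1) ℚ.* (r ℚ.- s (a + m))
      equal-remainders⇒tail-ratio a m same = begin
        r ℚ.- s a                           ≡⟨ r-s≡remainder/dQ a ⟩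
        + c / (d * Q a)                     ≡⟨ *≡*⇒+/≡+/ c (G * c) (d * Q a) (1 * (d * Q b)) cross ⟩
        + (G * c) / (1 * (d * Q b))         ≡⟨ +/*+/≡ G c 1 (d * Q b) ⟨
        (+ G / 1) ℚ.* (+ c / (d * Q b))     ≡⟨ cong (λ x → (+ G / 1) ℚ.* (+ x / (d * Q b))) same ⟩
        (+ G / 1) ℚ.* (+ remainder b / (d * Q b)) ≡⟨ cong ((+ G / 1) ℚ.*_) (r-s≡remainder/dQ b) ⟨
        (+ G / 1) ℚ.* (r ℚ.- s b)           ∎
        where
        open ≡-Reasoning
        b = a + m
        c = remainder a
        G = qprod q a m
        instance
          _ = dQ-nonZero a
          _ = dQ-nonZero b
          _ = ℕP.m*n≢0 1 (d * Q b)
        cross : c * (1 * (d * Q b)) ≡ G * c * (d * Q a)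
        cross = begin
          c * (1 * (d * Q b))        ≡⟨ cong (λ x → c * (1 * (d * x))) (qprod-+ q 0 a m) ⟩
          c * (1 * (d * (Q a * G)))  ≡⟨ reorder c d (Q a) G ⟩
          G * c * (d * Q a)          ∎
          where
          reorder : ∀ c d Q G → c * (1 * (d * (Q * G))) ≡ G * c * (d * Q)
          reorder = solve-∀

      periodicTail-at-repeat : ∀ n m → remainder n ≡ remainder (n + m) → PeriodicTail q hq e n m
      periodicTail-at-repeat n m same =
        tendsToZero-cong
          (λ M → sym (cong₂ (λ x y → x ℚ.- (+ qprod q n m / 1) ℚ.* y) (tailSum≡ n M) (tailSum≡ (n + m) M)))
          (limit⇒periodic-increments s n (n + m) (qprod q n m) s→p/d (equal-remainders⇒tail-ratio n m same))

    rational⇒periodicTail : SumIsRational q hq e → ∃[ n ] ∃[ m ] (1 ≤ m × PeriodicTail q hq e n m)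
    rational⇒periodicTail (r , s→r) = periodic (bounded-sequence-repeats remainder d remainder≤d)
      where
      d : ℕ
      d = ℚ.↧ₙ r
      open RationalLimit (ℚ.↥ r) d (subst (ConvergesTo s) (sym (ℚP.↥p/↧p≡p r)) s→r)
      periodic : ∃[ n ] ∃[ m ] (1 ≤ m × remainder n ≡ remainder (n + m)) →
                 ∃[ n ] ∃[ m ] (1 ≤ m × PeriodicTail q hq e n m)
      periodic (n , m , m≥1 , same) = n , m , m≥1 , periodicTail-at-repeat n m same

theorem3 : (q : ℕ → ℕ) (hq : IsBase q) (e : ℕ → ℕ) → (∀ k → 1 ≤ k → e k < q k) →
    SumIsRational q hq e ⇔ (∃[ n ] ∃[ m ] (1 ≤ m × PeriodicTail q hq e n m))
theorem3 q hq e he =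
  mk⇔ rational⇒periodicTail (λ (n , m , m≥1 , periodic) → periodicTail⇒rational n m m≥1 periodic)
  where
  open CantorSeries q hq e
  open BoundedDigits he
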